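{- Let $n\ge 3$ and let $S\subset[n-1]$ be a nonempty proper subset. Then \[\max\{d_H(\sigma,\rho):\sigma,\rho\in\mathcal{D}(S;n),\ \sigma\ne\rho\}=\begin{cases} n-1 & \text{if } S=\{i,i+1,\ldots,j\} \text{ (a set of consecutive integers) with } i=1 \text{ or } j=n-1,\\ n & \text{otherwise.}\end{cases}\]
   Context: $[m]=\{1,\ldots,m\}$. $S_n$ is the symmetric group on $[n]$, with permutations in one-line notation $\sigma=\sigma_1\cdots\sigma_n$. The descent set of $\sigma$ is $\mathcal{D}(\sigma)=\{i\in[n-1]:\sigma_i>\sigma_{i+1}\}$, and for $S\subseteq[n-1]$, $\mathcal{D}(S;n)=\{\sigma\in S_n:\mathcal{D}(\sigma)=S\}$. The Hamming metric is $d_H(\sigma,\rho)=|\{i\in[n]:\sigma_i\ne\rho_i\}|$. -}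

module Defs where

open import Data.Nat using (ℕ; suc; _≤_; _<_)
open import Data.Fin using (Fin; toℕ; inject₁; _≟_)
import Data.Fin as F
open import Data.Fin.Subset using (Subset; _∈_; _∉_; Nonempty; ∣_∣)
open import Data.Fin.Permutation using (Permutation′; _⟨$⟩ʳ_)
open import Data.Vec using (tabulate)
open import Data.Bool using (not)
open import Data.Product using (∃; ∃-syntax; _×_; _,_)
open import Data.Sum using (_⊎_)
open import Function.Bundles using (_⇔_)
open import Relation.Nullary using (¬_)
open import Relation.Nullary.Decidable using (⌊_⌋)
open import Relation.Binary.PropositionalEquality using (_≡_)

-- Convention: n = suc m, positions [n] are Fin (suc m) (0-indexed),
-- and [n-1] = {1,…,m} is represented by Fin m, where k : Fin m stands for
-- the integer toℕ k + 1.  A descent at k means σ_{k+1} > σ_{k+2} (1-indexed),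
-- i.e. σ(inject₁ k) > σ(suc k) in 0-indexed positions.

HasDescentSet : ∀ {m} → Subset m → Permutation′ (suc m) → Set
HasDescentSet {m} S σ =
  ∀ (k : Fin m) → (k ∈ S ⇔ (σ ⟨$⟩ʳ F.suc k) F.< (σ ⟨$⟩ʳ inject₁ k))

dH : ∀ {n} → Permutation′ n → Permutation′ n → ℕ
dH σ ρ = ∣ tabulate (λ i → not ⌊ (σ ⟨$⟩ʳ i) ≟ (ρ ⟨$⟩ʳ i) ⌋) ∣

_≉ₚ_ : ∀ {n} → Permutation′ n → Permutation′ n → Set
σ ≉ₚ ρ = ¬ (∀ i → σ ⟨$⟩ʳ i ≡ ρ ⟨$⟩ʳ i)

IsMaxDist : ∀ {m} → Subset m → ℕ → Set
IsMaxDist {m} S M =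
  (∃[ σ ] ∃[ ρ ] (HasDescentSet S σ × HasDescentSet S ρ × σ ≉ₚ ρ × dH σ ρ ≡ M))
  × (∀ σ ρ → HasDescentSet S σ → HasDescentSet S ρ → σ ≉ₚ ρ → dH σ ρ ≤ M)

ConsecutiveAtEnd : ∀ {m} → Subset m → Set
ConsecutiveAtEnd {m} S =
  ∃[ i ] ∃[ j ] ((∀ (k : Fin m) → (k ∈ S ⇔ (i ≤ suc (toℕ k) × suc (toℕ k) ≤ j)))
                 × (i ≡ 1 ⊎ j ≡ m))

{-# OPTIONS --safe #-}
-- Complementing values, x ↦ n + 1 - x, maps D(S; n) bijectively onto D(∁S; n), preserves Hamming
-- distance and preserves being consecutive at an end, so we may assume 1 ∉ S.  Then S starts with
-- i ≥ 1 ascents followed by a maximal run of c + 1 descents.  If that run reaches n - 1, every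
-- σ ∈ D(S; n) rises up to position i + 1 and falls afterwards, so σ(i + 1) = n and two such
-- permutations differ in at most n - 1 places.  In every case two explicit permutations, assembled
-- from direct and skew sums, realise the bound: they agree at most at position i + 1, and there
-- only when the run reaches n - 1.

module Submission where

open import Defs
open import Data.Bool using (Bool; true; false; not; if_then_else_)
open import Data.Bool.Properties using (¬-not; not-¬; not-involutive) renaming (_≟_ to _≟ᵇ_)
open import Data.Fin as Fin using (Fin; toℕ; fromℕ; fromℕ<; inject₁; opposite; punchOut; _≟_)
open import Data.Fin.Properties
  using (toℕ-injective; toℕ-fromℕ; toℕ-fromℕ<; toℕ<n; toℕ≤pred[n]; toℕ-inject₁; any?; punchOut-injective;
         injective⇒≤; opposite-prop; opposite-involutive)
open import Data.Fin.Permutation using (Permutation′; _⟨$⟩ʳ_; _⟨$⟩ˡ_; permutation; inverseˡ; inverseʳ; reverse; _∘ₚ_)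
open import Data.Fin.Subset using (Subset; _∈_; _∉_; _⊆_; ∁; ⁅_⁆; Nonempty; ∣_∣)
open import Data.Fin.Subset.Properties
  using (_∈?_; ⊆⊤; ⊆-antisym; ∣⊤∣≡n; ∣p∣≤n; p⊆q⇒∣p∣≤∣q∣; ∣∁p∣≡n∸∣p∣; ∣⁅x⁆∣≡1; x∈⁅x⁆; x∈⁅y⁆⇒x≡y;
         x∈∁p⇒x∉p; x∉p⇒x∈∁p; x∈p⇒x∉∁p)
open import Data.Nat using (ℕ; zero; suc; pred; _+_; _∸_; _≤_; _<_; _≥_; z≤n; s≤s; s≤s⁻¹; z<s)
  renaming (_≟_ to _≟ℕ_)
open import Data.Nat.DivMod using (_mod_; m<n⇒m%n≡m)
open import Data.Nat.Properties hiding (_≟_)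
open import Data.Product using (∃; ∃-syntax; _×_; _,_; proj₁; proj₂)
open import Data.Sum using (inj₁; inj₂)
open import Data.Vec using ([]; _∷_; lookup; tabulate)
open import Data.Vec.Properties using ([]=⇒lookup; lookup⇒[]=; lookup∘tabulate; lookup-map; map-∘; map-cong; map-id)
open import Function using (_∘_)
open import Function.Bundles using (_⇔_; mk⇔; Equivalence)
open import Function.Definitions using (Injective)
open import Relation.Binary.Definitions using (Reflexive; Transitive)
open import Relation.Binary.PropositionalEquality
open import Relation.Nullary using (¬_; Dec; yes; no; contradiction)
open import Relation.Nullary.Decidable using (⌊_⌋; isYes≗does; dec-true; dec-false)

-- Words over ℕ and their descent patterns

-- A word w(0) … w(len - 1) in one-line notation; `at` beyond len is irrelevant.
record Word : Set where
  constructor ⟨_,_⟩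
  field
    len : ℕ
    at  : ℕ → ℕ
open Word

resize : ∀ (Q : Word → Set) {w n} → len w ≡ n → Q w → Q ⟨ n , at w ⟩
resize Q refl q = q

InjectiveOn : Word → Set
InjectiveOn w = ∀ {p q} → p < len w → q < len w → at w p ≡ at w q → p ≡ q

record IsPermutation (w : Word) : Set where
  field
    bounded   : ∀ {p} → p < len w → at w p < len w
    injective : InjectiveOn w
open IsPermutation

Slope : Bool → ℕ → ℕ → Set
Slope false x y = x < y
Slope true  x y = y < x

Slope-resp : ∀ {b b′ x x′ y y′} → b ≡ b′ → x ≡ x′ → y ≡ y′ → Slope b x y → Slope b′ x′ y′
Slope-resp refl refl refl s = s

Slope-+ : ∀ a b {x y} → Slope b x y → Slope b (a + x) (a + y)
Slope-+ a false = +-monoʳ-< a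
Slope-+ a true  = +-monoʳ-< a

HasPattern : (ℕ → Bool) → Word → Set
HasPattern d w = ∀ j → suc j < len w → Slope (d j) (at w j) (at w (suc j))

HasPattern-cong : ∀ {d d′ w} → (∀ j → d j ≡ d′ j) → HasPattern d w → HasPattern d′ w
HasPattern-cong d≗d′ H j j+1< = Slope-resp (d≗d′ j) refl refl (H j j+1<)

data Split (k : ℕ) : ℕ → Set where
  below : ∀ {p} → p < k → Split k p
  above : ∀ q → Split k (k + q)

split : ∀ k p → Split k p
split k p with p <? k
... | yes p<k = below p<k
... | no  p≮k = subst (Split k) (m+[n∸m]≡n (≮⇒≥ p≮k)) (above (p ∸ k))

infixr 5 _++_
_++_ : Word → Word → Word
u ++ v = ⟨ len u + len v , concat ⟩
  where
  concat : ℕ → ℕ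
  concat p with p <? len u
  ... | yes _ = at u p
  ... | no  _ = at v (p ∸ len u)

raise : ℕ → Word → Word
raise a w = ⟨ len w , (λ p → a + at w p) ⟩

module _ (u v : Word) where

  ++-atˡ : ∀ {p} → p < len u → at (u ++ v) p ≡ at u p
  ++-atˡ {p} p<k with p <? len u
  ... | yes _   = refl
  ... | no  p≮k = contradiction p<k p≮k

  ++-atʳ : ∀ {p} q → p ≡ len u + q → at (u ++ v) p ≡ at v q
  ++-atʳ q refl with len u + q <? len u
  ... | yes k+q<k = contradiction k+q<k (m+n≮m (len u) q)
  ... | no  _     = cong (at v) (m+n∸m≡n (len u) q)

  private
    offset< : ∀ {p} q → p ≡ len u + q → p < len u + len v → q < len v
    offset< q refl = +-cancelˡ-< (len u) q (len v)

  ++-injective : InjectiveOn u → InjectiveOn v →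
                 (∀ {p q} → p < len u → q < len v → at u p ≢ at v q) → InjectiveOn (u ++ v)
  ++-injective inj-u inj-v disjoint {p} {q} p< q< eq with split (len u) p | split (len u) q
  ... | below p<k | below q<k =
    inj-u p<k q<k (trans (sym (++-atˡ p<k)) (trans eq (++-atˡ q<k)))
  ... | below p<k | above q′ =
    contradiction (trans (sym (++-atˡ p<k)) (trans eq (++-atʳ q′ refl))) (disjoint p<k (offset< q′ refl q<))
  ... | above p′ | below q<k =
    contradiction (trans (sym (++-atˡ q<k)) (trans (sym eq) (++-atʳ p′ refl))) (disjoint q<k (offset< p′ refl p<))
  ... | above p′ | above q′ =
    cong (len u +_) (inj-v (offset< p′ refl p<) (offset< q′ refl q<)
      (trans (sym (++-atʳ p′ refl)) (trans eq (++-atʳ q′ refl))))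

  ++-pattern : ∀ {d} → HasPattern d u → HasPattern (λ j → d (len u + j)) v →
               (∀ j → suc j ≡ len u → 0 < len v → Slope (d j) (at u j) (at v 0)) → HasPattern d (u ++ v)
  ++-pattern {d} Hu Hv junction j j+1< with split (len u) j
  ... | above q =
    Slope-resp refl (sym (++-atʳ q refl)) (sym (++-atʳ (suc q) j+1≡)) (Hv q (offset< (suc q) j+1≡ j+1<))
    where
    j+1≡ : suc (len u + q) ≡ len u + suc q
    j+1≡ = sym (+-suc (len u) q)
  ... | below j<k with m≤n⇒m<n∨m≡n j<k
  ...   | inj₁ j+1<k = Slope-resp refl (sym (++-atˡ j<k)) (sym (++-atˡ j+1<k)) (Hu j j+1<k)
  ...   | inj₂ j+1≡k =
    Slope-resp refl (sym (++-atˡ j<k)) (sym (++-atʳ 0 j+1≡)) (junction j j+1≡k (offset< 0 j+1≡ j+1<))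
    where
    j+1≡ : suc j ≡ len u + 0
    j+1≡ = trans j+1≡k (sym (+-identityʳ (len u)))

raise-injective : ∀ a {w} → InjectiveOn w → InjectiveOn (raise a w)
raise-injective a inj p< q< eq = inj p< q< (+-cancelˡ-≡ a _ _ eq)

raise-pattern : ∀ a {d w} → HasPattern d w → HasPattern d (raise a w)
raise-pattern a H j j+1< = Slope-+ a _ (H j j+1<)

infixr 6 _⊕_ _⊖_
_⊕_ _⊖_ : Word → Word → Word
u ⊕ v = u ++ raise (len u) v
u ⊖ v = raise (len v) u ++ v

module _ {u v : Word} (U : IsPermutation u) (V : IsPermutation v) where

  ⊕-isPermutation : IsPermutation (u ⊕ v)
  ⊕-isPermutation = record
    { bounded   = bounded′
    ; injective = ++-injective u _ (injective U) (raise-injective (len u) (injective V))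
                    (λ p< _ → <⇒≢ (<-≤-trans (bounded U p<) (m≤m+n (len u) _)))
    }
    where
    bounded′ : ∀ {p} → p < len u + len v → at (u ⊕ v) p < len u + len v
    bounded′ {p} p< with split (len u) p
    ... | below p<k = subst (_< _) (sym (++-atˡ u _ p<k)) (<-≤-trans (bounded U p<k) (m≤m+n _ _))
    ... | above q   = subst (_< _) (sym (++-atʳ u _ q refl))
                        (+-monoʳ-< (len u) (bounded V (+-cancelˡ-< (len u) q _ p<)))

  ⊖-isPermutation : IsPermutation (u ⊖ v)
  ⊖-isPermutation = record
    { bounded   = bounded′
    ; injective = ++-injective _ v (raise-injective (len v) (injective U)) (injective V)
                    (λ _ q< eq → <⇒≢ (<-≤-trans (bounded V q<) (m≤m+n (len v) _)) (sym eq))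
    }
    where
    bounded′ : ∀ {p} → p < len u + len v → at (u ⊖ v) p < len u + len v
    bounded′ {p} p< with split (len u) p
    ... | below p<k = subst₂ _<_ (sym (++-atˡ (raise (len v) u) v p<k)) (+-comm (len v) (len u))
                        (+-monoʳ-< (len v) (bounded U p<k))
    ... | above q   = subst (_< _) (sym (++-atʳ (raise (len v) u) v q refl))
                        (<-≤-trans (bounded V (+-cancelˡ-< (len u) q _ p<)) (m≤n+m _ _))

  ⊕-pattern : ∀ {d} → HasPattern d u → HasPattern (λ j → d (len u + j)) v →
              (∀ j → suc j ≡ len u → 0 < len v → d j ≡ false) → HasPattern d (u ⊕ v)
  ⊕-pattern Hu Hv ascent = ++-pattern u _ Hu (raise-pattern (len u) Hv) λ j j+1≡k 0<l →
    Slope-resp (sym (ascent j j+1≡k 0<l)) refl refl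
      (<-≤-trans (bounded U (≤-reflexive j+1≡k)) (m≤m+n (len u) _))

  ⊖-pattern : ∀ {d} → HasPattern d u → HasPattern (λ j → d (len u + j)) v →
              (∀ j → suc j ≡ len u → 0 < len v → d j ≡ true) → HasPattern d (u ⊖ v)
  ⊖-pattern Hu Hv descent = ++-pattern _ v (raise-pattern (len v) Hu) Hv λ j j+1≡k 0<l →
    Slope-resp (sym (descent j j+1≡k 0<l)) refl refl
      (<-≤-trans (bounded V 0<l) (m≤m+n (len v) _))

module _ (u v : Word) where

  ⊕-atˡ : ∀ {p} → p < len u → at (u ⊕ v) p ≡ at u p
  ⊕-atˡ = ++-atˡ u (raise (len u) v)

  ⊕-atʳ : ∀ {p} q → p ≡ len u + q → at (u ⊕ v) p ≡ len u + at v q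
  ⊕-atʳ = ++-atʳ u (raise (len u) v)

  ⊖-atˡ : ∀ {p} → p < len u → at (u ⊖ v) p ≡ len v + at u p
  ⊖-atˡ = ++-atˡ (raise (len v) u) v

  ⊖-atʳ : ∀ {p} q → p ≡ len u + q → at (u ⊖ v) p ≡ at v q
  ⊖-atʳ = ++-atʳ (raise (len v) u) v

ascending descending : ℕ → Word
ascending  n = ⟨ n , (λ p → p) ⟩
descending n = ⟨ n , (λ p → n ∸ suc p) ⟩

ascending-isPermutation : ∀ n → IsPermutation (ascending n)
ascending-isPermutation n = record { bounded = λ p< → p< ; injective = λ _ _ eq → eq }

descending-isPermutation : ∀ n → IsPermutation (descending n)
descending-isPermutation n = record
  { bounded   = ∸-monoʳ-< z<s
  ; injective = λ p< q< eq → suc-injective (∸-cancelˡ-≡ p< q< eq)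
  }

ascending-pattern : ∀ {d} n → (∀ j → suc j < n → d j ≡ false) → HasPattern d (ascending n)
ascending-pattern n ascent j j+1< = Slope-resp (sym (ascent j j+1<)) refl refl (n<1+n j)

descending-pattern : ∀ {d} n → (∀ j → suc j < n → d j ≡ true) → HasPattern d (descending n)
descending-pattern n descent j j+1< =
  Slope-resp (sym (descent j j+1<)) refl refl (∸-monoʳ-< (n<1+n (suc j)) j+1<)

greedy : (ℕ → Bool) → ℕ → Word
greedy d zero    = ascending 0
greedy d (suc n) = if d 0 then ascending 1 ⊖ rest else ascending 1 ⊕ rest
  where
  rest : Word
  rest = greedy (λ j → d (suc j)) n

len-greedy : ∀ d n → len (greedy d n) ≡ n
len-greedy d zero = refl
len-greedy d (suc n) with d 0
... | true  = cong suc (len-greedy _ n)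
... | false = cong suc (len-greedy _ n)

greedy-isPermutation : ∀ d n → IsPermutation (greedy d n)
greedy-isPermutation d zero = ascending-isPermutation 0
greedy-isPermutation d (suc n) with d 0
... | true  = ⊖-isPermutation (ascending-isPermutation 1) (greedy-isPermutation _ n)
... | false = ⊕-isPermutation (ascending-isPermutation 1) (greedy-isPermutation _ n)

greedy-pattern : ∀ d n → HasPattern d (greedy d n)
greedy-pattern d zero _ ()
greedy-pattern d (suc n) with d 0 in d0
... | true  = ⊖-pattern (ascending-isPermutation 1) (greedy-isPermutation _ n)
                (ascending-pattern 1 λ { _ (s≤s ()) }) (greedy-pattern _ n) λ { zero _ _ → d0 }
... | false = ⊕-pattern (ascending-isPermutation 1) (greedy-isPermutation _ n)
                (ascending-pattern 1 λ { _ (s≤s ()) }) (greedy-pattern _ n) λ { zero _ _ → d0 }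

-- Unimodal words and runs of a pattern

chain : ∀ (_R_ : ℕ → ℕ → Set) → Reflexive _R_ → Transitive _R_ → ∀ (f : ℕ → ℕ) {p q} → p ≤ q →
        (∀ j → p ≤ j → j < q → f j R f (suc j)) → f p R f q
chain _R_ R-refl R-trans f {q = zero}  z≤n   _    = R-refl
chain _R_ R-refl R-trans f {q = suc q} p≤q+1 step with m≤n⇒m<n∨m≡n p≤q+1
... | inj₂ refl       = R-refl
... | inj₁ (s≤s p≤q) = R-trans (chain _R_ R-refl R-trans f p≤q λ j p≤j j<q → step j p≤j (m<n⇒m<1+n j<q))
                               (step q p≤q (n<1+n q))

peak-maximal : ∀ {d w i} → HasPattern d w → i < len w →
               (∀ j → j < i → d j ≡ false) → (∀ j → i ≤ j → suc j < len w → d j ≡ true) →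
               ∀ {p} → p < len w → at w p ≤ at w i
peak-maximal {w = w} {i} H i< ascent descent {p} p< with ≤-total p i
... | inj₁ p≤i = chain _≤_ ≤-refl ≤-trans (at w) p≤i λ j _ j<i →
  <⇒≤ (Slope-resp (ascent j j<i) refl refl (H j (≤-<-trans j<i i<)))
... | inj₂ i≤p = chain _≥_ ≤-refl (λ x≥y y≥z → ≤-trans y≥z x≥y) (at w) i≤p λ j i≤j j<p →
  <⇒≤ (Slope-resp (descent j i≤j (≤-<-trans j<p p<)) refl refl (H j (≤-<-trans j<p p<)))

maximalRun : (P : ℕ → Bool) (b : Bool) (n : ℕ) →
             ∃[ l ] l ≤ n × (∀ j → j < l → P j ≡ b) × (l < n → P l ≡ not b)
maximalRun P b zero = 0 , z≤n , (λ _ ()) , (λ ())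
maximalRun P b (suc n) with P 0 ≟ᵇ b
... | no P0≢b = 0 , z≤n , (λ _ ()) , (λ _ → ¬-not P0≢b)
... | yes P0≡b with l , l≤n , run , end ← maximalRun (λ j → P (suc j)) b n =
  suc l , s≤s l≤n , (λ { zero _ → P0≡b ; (suc j) j<l → run j (s≤s⁻¹ j<l) }) , (λ l<n → end (s≤s⁻¹ l<n))

record FirstDescentRun (d : ℕ → Bool) (m : ℕ) : Set where
  field
    i c r       : ℕ
    1≤i         : 1 ≤ i
    m≡          : m ≡ i + suc c + r
    ascents     : ∀ j → j < i → d j ≡ false
    descents    : ∀ j → j ≤ c → d (i + j) ≡ true
    ascentAfter : 0 < r → d (i + suc c) ≡ false

  descentsToEnd : r ≡ 0 → ∀ j → i ≤ j → j < m → d j ≡ true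
  descentsToEnd r≡0 j i≤j j<m with split i j
  ... | below j<i = contradiction i≤j (<⇒≱ j<i)
  ... | above q   = descents q (s≤s⁻¹ (+-cancelˡ-< i q (suc c) (subst (i + q <_) m≡i+c+1 j<m)))
    where
    m≡i+c+1 : m ≡ i + suc c
    m≡i+c+1 = trans m≡ (trans (cong (i + suc c +_) r≡0) (+-identityʳ _))

firstDescentRun : ∀ {d m} → d 0 ≡ false → (∃[ k ] k < m × d k ≡ true) → FirstDescentRun d m
firstDescentRun {d} {m} d0 (k , k<m , dk)
  with i , i≤m , ascents , atI ← maximalRun d false m
  with c , c≤ , descents , atEnd ← maximalRun (λ j → d (suc i + j)) true (m ∸ suc i) = record
    { i = i ; c = c ; r = m ∸ suc i ∸ c ; 1≤i = 1≤i ; m≡ = m≡ ; ascents = ascents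
    ; descents = descents′ ; ascentAfter = ascentAfter }
  where
  open ≡-Reasoning
  i<m : i < m
  i<m with m≤n⇒m<n∨m≡n i≤m
  ... | inj₁ i<m = i<m
  ... | inj₂ refl = contradiction (ascents k k<m) (not-¬ dk)

  descentAtI : d i ≡ true
  descentAtI = atI i<m

  1≤i : 1 ≤ i
  1≤i = n≢0⇒n>0 λ i≡0 → contradiction d0 (not-¬ (subst (λ x → d x ≡ true) i≡0 descentAtI))

  m≡ : m ≡ i + suc c + (m ∸ suc i ∸ c)
  m≡ = begin
    m                               ≡⟨ m+[n∸m]≡n i<m ⟨
    suc i + (m ∸ suc i)             ≡⟨ cong (suc i +_) (m+[n∸m]≡n c≤) ⟨
    suc i + (c + (m ∸ suc i ∸ c))   ≡⟨ cong suc (+-assoc i c _) ⟨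
    suc (i + c) + (m ∸ suc i ∸ c)   ≡⟨ cong (_+ (m ∸ suc i ∸ c)) (+-suc i c) ⟨
    i + suc c + (m ∸ suc i ∸ c)     ∎

  descents′ : ∀ j → j ≤ c → d (i + j) ≡ true
  descents′ zero    _     = subst (λ x → d x ≡ true) (sym (+-identityʳ i)) descentAtI
  descents′ (suc j) j<c   = subst (λ x → d x ≡ true) (sym (+-suc i j)) (descents j j<c)

  ascentAfter : 0 < m ∸ suc i ∸ c → d (i + suc c) ≡ false
  ascentAfter 0<r = subst (λ x → d x ≡ false) (sym (+-suc i c)) (atEnd (m∸n≢0⇒n<m (n>0⇒n≢0 0<r)))

-- With i′ = i + c + 1 and t = tail (a permutation of the last r positions with their descent pattern):
--   position   0 … i-1       i     i+1 … i′     i′+1 … m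
--   σ          0 … i-1       m     i+c … i      i′ + t
--   ρ          c+1 … c+i     i′    c … 0        i′+1 + t
module WitnessWords {d : ℕ → Bool} {m : ℕ} (run : FirstDescentRun d m) where
  open FirstDescentRun run
  open ≡-Reasoning

  tail fall σ-rest ρ-head σ ρ : Word
  tail   = greedy (λ s → d (suc (i + suc c + s))) r
  fall   = descending (suc c)
  σ-rest = ascending 1 ⊖ (fall ⊕ tail)
  ρ-head = ascending (suc i) ⊖ fall
  σ      = ascending i ⊕ σ-rest
  ρ      = ρ-head ⊕ tail

  len-tail : len tail ≡ r
  len-tail = len-greedy _ r

  len-σ : len σ ≡ suc m
  len-σ = begin
    i + suc (suc c + len tail)   ≡⟨ +-suc i _ ⟩
    suc (i + (suc c + len tail)) ≡⟨ cong suc (+-assoc i (suc c) _) ⟨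
    suc (i + suc c + len tail)   ≡⟨ cong (λ x → suc (i + suc c + x)) len-tail ⟩
    suc (i + suc c + r)          ≡⟨ cong suc m≡ ⟨
    suc m                        ∎

  len-ρ : len ρ ≡ suc m
  len-ρ = cong suc (trans (cong (i + suc c +_) len-tail) (sym m≡))

  private
    tail-isPermutation : IsPermutation tail
    tail-isPermutation = greedy-isPermutation _ r

    fall-isPermutation : IsPermutation fall
    fall-isPermutation = descending-isPermutation (suc c)

    fall⊕tail-isPermutation : IsPermutation (fall ⊕ tail)
    fall⊕tail-isPermutation = ⊕-isPermutation fall-isPermutation tail-isPermutation

    σ-rest-isPermutation : IsPermutation σ-rest
    σ-rest-isPermutation = ⊖-isPermutation (ascending-isPermutation 1) fall⊕tail-isPermutation

    ρ-head-isPermutation : IsPermutation ρ-head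
    ρ-head-isPermutation = ⊖-isPermutation (ascending-isPermutation (suc i)) fall-isPermutation

  σ-isPermutation : IsPermutation σ
  σ-isPermutation = ⊕-isPermutation (ascending-isPermutation i) σ-rest-isPermutation

  ρ-isPermutation : IsPermutation ρ
  ρ-isPermutation = ⊕-isPermutation ρ-head-isPermutation tail-isPermutation

  private
    descentAt : ∀ {j} k → j ≡ i + k → k ≤ c → d j ≡ true
    descentAt k refl = descents k

    ascentAfterRun : ∀ {j} → j ≡ i + suc c → 0 < len tail → d j ≡ false
    ascentAfterRun refl 0<l = ascentAfter (subst (0 <_) len-tail 0<l)

    tail-pattern : HasPattern (λ s → d (suc (i + suc c + s))) tail
    tail-pattern = greedy-pattern _ r

    fall⊕tail-pattern : HasPattern (λ j → d (i + suc j)) (fall ⊕ tail)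
    fall⊕tail-pattern = ⊕-pattern fall-isPermutation tail-isPermutation
      (descending-pattern (suc c) λ j j+1<c+1 → descents (suc j) (s≤s⁻¹ j+1<c+1))
      (HasPattern-cong (λ s → cong d (shift s)) tail-pattern)
      (λ { j refl → ascentAfterRun refl })
      where
      shift : ∀ s → suc (i + suc c + s) ≡ i + suc (suc c + s)
      shift s = trans (cong suc (+-assoc i (suc c) s)) (sym (+-suc i (suc c + s)))

    σ-rest-pattern : HasPattern (λ j → d (i + j)) σ-rest
    σ-rest-pattern = ⊖-pattern (ascending-isPermutation 1) fall⊕tail-isPermutation
      (ascending-pattern 1 λ { _ (s≤s ()) }) fall⊕tail-pattern (λ { zero _ _ → descents 0 z≤n })

    ρ-head-pattern : HasPattern d ρ-head
    ρ-head-pattern = ⊖-pattern (ascending-isPermutation (suc i)) fall-isPermutation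
      (ascending-pattern (suc i) λ j j+1<i+1 → ascents j (s≤s⁻¹ j+1<i+1))
      (descending-pattern (suc c) λ j j+1<c+1 → descentAt (suc j) (sym (+-suc i j)) (s≤s⁻¹ j+1<c+1))
      (λ { j refl _ → descentAt 0 (sym (+-identityʳ i)) z≤n })

  σ-pattern : HasPattern d σ
  σ-pattern = ⊕-pattern (ascending-isPermutation i) σ-rest-isPermutation
    (ascending-pattern i λ j j+1<i → ascents j (<-trans (n<1+n j) j+1<i))
    σ-rest-pattern
    (λ j j+1≡i _ → ascents j (≤-reflexive j+1≡i))

  ρ-pattern : HasPattern d ρ
  ρ-pattern = ⊕-pattern ρ-head-isPermutation tail-isPermutation ρ-head-pattern tail-pattern
    (λ { j refl → ascentAfterRun refl })

  private
    σ-at-below : ∀ {p} → p < i → at σ p ≡ p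
    σ-at-below = ⊕-atˡ (ascending i) σ-rest

    σ-at-fall : ∀ y → y < suc c → at σ (suc i + y) ≡ i + (c ∸ y)
    σ-at-fall y y<c+1 = begin
      at σ (suc i + y)          ≡⟨ ⊕-atʳ (ascending i) σ-rest (suc y) (sym (+-suc i y)) ⟩
      i + at σ-rest (suc y)     ≡⟨ cong (i +_) (⊖-atʳ (ascending 1) (fall ⊕ tail) y refl) ⟩
      i + at (fall ⊕ tail) y    ≡⟨ cong (i +_) (⊕-atˡ fall tail y<c+1) ⟩
      i + (c ∸ y)               ∎

    σ-at-tail : ∀ s → at σ (suc i + (suc c + s)) ≡ i + (suc c + at tail s)
    σ-at-tail s = begin
      at σ (suc i + (suc c + s))          ≡⟨ ⊕-atʳ (ascending i) σ-rest (suc (suc c + s)) (sym (+-suc i _)) ⟩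
      i + at σ-rest (suc (suc c + s))     ≡⟨ cong (i +_) (⊖-atʳ (ascending 1) (fall ⊕ tail) (suc c + s) refl) ⟩
      i + at (fall ⊕ tail) (suc c + s)    ≡⟨ cong (i +_) (⊕-atʳ fall tail s refl) ⟩
      i + (suc c + at tail s)             ∎

    ρ-at-head : ∀ {p} → p < suc i → at ρ p ≡ suc c + p
    ρ-at-head p<i+1 = trans (⊕-atˡ ρ-head tail (<-≤-trans p<i+1 (m≤m+n (suc i) (suc c))))
                            (⊖-atˡ (ascending (suc i)) fall p<i+1)

    ρ-at-fall : ∀ y → y < suc c → at ρ (suc i + y) ≡ c ∸ y
    ρ-at-fall y y<c+1 = trans (⊕-atˡ ρ-head tail (+-monoʳ-< (suc i) y<c+1))
                              (⊖-atʳ (ascending (suc i)) fall y refl)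

    ρ-at-tail : ∀ s → at ρ (suc i + (suc c + s)) ≡ suc (i + suc c + at tail s)
    ρ-at-tail s = ⊕-atʳ ρ-head tail s (sym (+-assoc (suc i) (suc c) s))

  σ≢ρ : ∀ p → p ≢ i → at σ p ≢ at ρ p
  σ≢ρ p p≢i with split (suc i) p
  ... | below p<i+1 with m≤n⇒m<n∨m≡n (s≤s⁻¹ p<i+1)
  ...   | inj₂ p≡i = contradiction p≡i p≢i
  ...   | inj₁ p<i = λ eq → m≢1+n+m p (trans (sym (σ-at-below p<i)) (trans eq (ρ-at-head p<i+1)))
  σ≢ρ _ _ | above q with split (suc c) q
  ... | below y<c+1 = λ eq → <⇒≢ (m<n+m (c ∸ q) 1≤i)
          (trans (sym (ρ-at-fall q y<c+1)) (trans (sym eq) (σ-at-fall q y<c+1)))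
  ... | above s = λ eq → 1+n≢n (sym (begin
          i + suc c + at tail s          ≡⟨ +-assoc i (suc c) _ ⟩
          i + (suc c + at tail s)        ≡⟨ σ-at-tail s ⟨
          at σ (suc i + (suc c + s))     ≡⟨ eq ⟩
          at ρ (suc i + (suc c + s))     ≡⟨ ρ-at-tail s ⟩
          suc (i + suc c + at tail s)    ∎))

  σ-at-peak : at σ i ≡ at ρ i + r
  σ-at-peak = begin
    at σ i                          ≡⟨ ⊕-atʳ (ascending i) σ-rest 0 (sym (+-identityʳ i)) ⟩
    i + at σ-rest 0                 ≡⟨ cong (i +_) (⊖-atˡ (ascending 1) (fall ⊕ tail) z<s) ⟩
    i + (suc c + len tail + 0)      ≡⟨ cong (λ x → i + x) (+-identityʳ _) ⟩
    i + (suc c + len tail)          ≡⟨ cong (λ x → i + (suc c + x)) len-tail ⟩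
    i + (suc c + r)                 ≡⟨ +-assoc i (suc c) r ⟨
    i + suc c + r                   ≡⟨ cong (_+ r) (+-comm i (suc c)) ⟩
    suc c + i + r                   ≡⟨ cong (_+ r) (ρ-at-head (n<1+n i)) ⟨
    at ρ i + r                      ∎


-- Permutations of Fin n as words

-- A value y missed by f could be punched out, injecting Fin (suc n) into Fin n.
injective⇒surjective : ∀ {n} {f : Fin n → Fin n} → Injective _≡_ _≡_ f → ∀ y → ∃[ x ] f x ≡ y
injective⇒surjective {suc n} {f} f-inj y with any? (λ x → f x ≟ y)
... | yes hit  = hit
... | no  miss = contradiction (injective⇒≤ punchOut∘f-injective) 1+n≰n
  where
  avoids : ∀ x → y ≢ f x
  avoids x y≡fx = miss (x , sym y≡fx)
  punchOut∘f-injective : Injective _≡_ _≡_ (λ x → punchOut (avoids x))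
  punchOut∘f-injective eq = f-inj (punchOut-injective (avoids _) (avoids _) eq)

fromInjective : ∀ {n} (f : Fin n → Fin n) → Injective _≡_ _≡_ f → Permutation′ n
fromInjective f f-inj = permutation f (proj₁ ∘ surj) (proj₂ ∘ surj) (λ x → f-inj (proj₂ (surj (f x))))
  where
  surj : ∀ y → ∃[ x ] f x ≡ y
  surj = injective⇒surjective f-inj

permutation-injective : ∀ {n} (τ : Permutation′ n) → Injective _≡_ _≡_ (τ ⟨$⟩ʳ_)
permutation-injective τ eq = trans (sym (inverseˡ τ)) (trans (cong (τ ⟨$⟩ˡ_) eq) (inverseˡ τ))

toPermutation : (w : Word) → IsPermutation w → Permutation′ (len w)
toPermutation w P = fromInjective (λ x → fromℕ< (bounded P (toℕ<n x))) λ eq →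
  toℕ-injective (injective P (toℕ<n _) (toℕ<n _) (trans (sym (toℕ-fromℕ< _)) (trans (cong toℕ eq) (toℕ-fromℕ< _))))

toPermutation-at : ∀ w (P : IsPermutation w) x → toℕ (toPermutation w P ⟨$⟩ʳ x) ≡ at w (toℕ x)
toPermutation-at w P x = toℕ-fromℕ< _

-- Positions past m are read modulo m + 1; only 0 … m matter.
oneLine : ∀ {m} → Permutation′ (suc m) → Word
oneLine {m} τ = ⟨ suc m , (λ p → toℕ (τ ⟨$⟩ʳ (p mod suc m))) ⟩

oneLine-at : ∀ {m} (τ : Permutation′ (suc m)) x → toℕ (τ ⟨$⟩ʳ x) ≡ at (oneLine τ) (toℕ x)
oneLine-at τ x = cong (λ y → toℕ (τ ⟨$⟩ʳ y)) (toℕ-injective (sym (trans (toℕ-fromℕ< _) (m<n⇒m%n≡m (toℕ<n x)))))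

-- The descent set as a pattern on 0-indexed positions; positions from m on read as false.
indicator : ∀ {m} → Subset m → ℕ → Bool
indicator []      _       = false
indicator (b ∷ S) zero    = b
indicator (b ∷ S) (suc j) = indicator S j

indicator-lookup : ∀ {m} (S : Subset m) k → indicator S (toℕ k) ≡ lookup S k
indicator-lookup (b ∷ S) Fin.zero    = refl
indicator-lookup (b ∷ S) (Fin.suc k) = indicator-lookup S k

module _ {m} {S : Subset m} {k : Fin m} where

  ∈⇒indicator : k ∈ S → indicator S (toℕ k) ≡ true
  ∈⇒indicator k∈S = trans (indicator-lookup S k) ([]=⇒lookup k∈S)

  indicator⇒∈ : indicator S (toℕ k) ≡ true → k ∈ S
  indicator⇒∈ eq = lookup⇒[]= k S (trans (sym (indicator-lookup S k)) eq)

  ∉⇒indicator : k ∉ S → indicator S (toℕ k) ≡ false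
  ∉⇒indicator k∉S = ¬-not (k∉S ∘ indicator⇒∈)

  slope⇒descentAt : ∀ {a b} → Slope (indicator S (toℕ k)) a b → (k ∈ S ⇔ b < a)
  slope⇒descentAt s with indicator S (toℕ k) in e
  ... | true  = mk⇔ (λ _ → s) (λ _ → indicator⇒∈ e)
  ... | false = mk⇔ (λ k∈S → contradiction (∈⇒indicator k∈S) (not-¬ e)) (λ b<a → contradiction s (<-asym b<a))

  descentAt⇒slope : ∀ {a b} → a ≢ b → (k ∈ S ⇔ b < a) → Slope (indicator S (toℕ k)) a b
  descentAt⇒slope a≢b k∈S⇔b<a with indicator S (toℕ k) in e
  ... | true  = Equivalence.to k∈S⇔b<a (indicator⇒∈ e)
  ... | false = ≤∧≢⇒< (≮⇒≥ (λ b<a → not-¬ e (∈⇒indicator (Equivalence.from k∈S⇔b<a b<a)))) a≢b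

indicator⇔ : ∀ {m} {S : Subset m} (P : ℕ → Set) → (∀ k → k ∈ S ⇔ P (toℕ k)) →
             ∀ {j} → j < m → indicator S j ≡ true ⇔ P j
indicator⇔ {m} {S} P S≡P {j} j<m = mk⇔
  (λ Sj → subst P k≡j (Equivalence.to (S≡P k) (indicator⇒∈ (subst (λ x → indicator S x ≡ true) (sym k≡j) Sj))))
  (λ Pj → subst (λ x → indicator S x ≡ true) k≡j (∈⇒indicator (Equivalence.from (S≡P k) (subst P (sym k≡j) Pj))))
  where
  k : Fin m
  k = fromℕ< j<m
  k≡j : toℕ k ≡ j
  k≡j = toℕ-fromℕ< j<m

adjacent-distinct : ∀ {m} (τ : Permutation′ (suc m)) (k : Fin m) →
                    toℕ (τ ⟨$⟩ʳ inject₁ k) ≢ toℕ (τ ⟨$⟩ʳ Fin.suc k)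
adjacent-distinct τ k eq = 1+n≢n (sym (trans (sym (toℕ-inject₁ k))
  (cong toℕ (permutation-injective τ (toℕ-injective eq)))))

module _ {m} (S : Subset m) (τ : Permutation′ (suc m)) {f : ℕ → ℕ} (τ≗f : ∀ x → toℕ (τ ⟨$⟩ʳ x) ≡ f (toℕ x)) where

  private
    at-inject₁ : ∀ k → toℕ (τ ⟨$⟩ʳ inject₁ k) ≡ f (toℕ k)
    at-inject₁ k = trans (τ≗f (inject₁ k)) (cong f (toℕ-inject₁ k))

  pattern⇒descentSet : HasPattern (indicator S) ⟨ suc m , f ⟩ → HasDescentSet S τ
  pattern⇒descentSet H k = slope⇒descentAt
    (Slope-resp refl (sym (at-inject₁ k)) (sym (τ≗f (Fin.suc k))) (H (toℕ k) (s≤s (toℕ<n k))))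

  descentSet⇒pattern : HasDescentSet S τ → HasPattern (indicator S) ⟨ suc m , f ⟩
  descentSet⇒pattern H j (s≤s j<m) = subst (λ x → Slope (indicator S x) (f x) (f (suc x))) (toℕ-fromℕ< j<m)
    (Slope-resp refl (at-inject₁ k) (τ≗f (Fin.suc k)) (descentAt⇒slope (adjacent-distinct τ k) (H k)))
    where
    k : Fin m
    k = fromℕ< j<m

-- Hamming distance

disagreement : ∀ {n} → Permutation′ n → Permutation′ n → Subset n
disagreement σ ρ = tabulate (λ x → not ⌊ σ ⟨$⟩ʳ x ≟ ρ ⟨$⟩ʳ x ⌋)

module _ {n} (σ ρ : Permutation′ n) where

  private
    agree? : ∀ x → Dec (σ ⟨$⟩ʳ x ≡ ρ ⟨$⟩ʳ x)
    agree? x = σ ⟨$⟩ʳ x ≟ ρ ⟨$⟩ʳ x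

  ∈-disagreement⁺ : ∀ {x} → σ ⟨$⟩ʳ x ≢ ρ ⟨$⟩ʳ x → x ∈ disagreement σ ρ
  ∈-disagreement⁺ {x} σx≢ρx = lookup⇒[]= x _
    (trans (lookup∘tabulate _ x) (cong not (trans (isYes≗does (agree? x)) (dec-false (agree? x) σx≢ρx))))

  ∈-disagreement⁻ : ∀ {x} → x ∈ disagreement σ ρ → σ ⟨$⟩ʳ x ≢ ρ ⟨$⟩ʳ x
  ∈-disagreement⁻ {x} x∈ σx≡ρx = not-¬ (cong not (trans (isYes≗does (agree? x)) (dec-true (agree? x) σx≡ρx)))
    (trans (sym (lookup∘tabulate _ x)) ([]=⇒lookup x∈))

  dH-everywhere : (∀ x → σ ⟨$⟩ʳ x ≢ ρ ⟨$⟩ʳ x) → dH σ ρ ≡ n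
  dH-everywhere σ≢ρ = trans (cong ∣_∣ (⊆-antisym ⊆⊤ (λ {x} _ → ∈-disagreement⁺ (σ≢ρ x)))) (∣⊤∣≡n n)

module _ {m} (σ ρ : Permutation′ (suc m)) (x : Fin (suc m)) (σx≡ρx : σ ⟨$⟩ʳ x ≡ ρ ⟨$⟩ʳ x) where

  private
    ∣∁⁅x⁆∣≡m : ∣ ∁ ⁅ x ⁆ ∣ ≡ m
    ∣∁⁅x⁆∣≡m = trans (∣∁p∣≡n∸∣p∣ ⁅ x ⁆) (cong (suc m ∸_) (∣⁅x⁆∣≡1 x))

    disagreement⊆∁⁅x⁆ : disagreement σ ρ ⊆ ∁ ⁅ x ⁆
    disagreement⊆∁⁅x⁆ y∈ = x∉p⇒x∈∁p λ y∈⁅x⁆ →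
      ∈-disagreement⁻ σ ρ y∈ (subst (λ y → σ ⟨$⟩ʳ y ≡ ρ ⟨$⟩ʳ y) (sym (x∈⁅y⁆⇒x≡y x y∈⁅x⁆)) σx≡ρx)

  dH-agreeAt : dH σ ρ ≤ m
  dH-agreeAt = ≤-trans (p⊆q⇒∣p∣≤∣q∣ disagreement⊆∁⁅x⁆) (≤-reflexive ∣∁⁅x⁆∣≡m)

  dH-agreeOnlyAt : (∀ y → y ≢ x → σ ⟨$⟩ʳ y ≢ ρ ⟨$⟩ʳ y) → dH σ ρ ≡ m
  dH-agreeOnlyAt σ≢ρ = trans (cong ∣_∣ (⊆-antisym disagreement⊆∁⁅x⁆ λ {y} y∈∁⁅x⁆ →
    ∈-disagreement⁺ σ ρ (σ≢ρ y λ { refl → x∈∁p⇒x∉p y∈∁⁅x⁆ (x∈⁅x⁆ x) }))) ∣∁⁅x⁆∣≡m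

-- Complementation

Slope-flip : ∀ b {M x y} → x ≤ M → y ≤ M → Slope b x y → Slope (not b) (M ∸ x) (M ∸ y)
Slope-flip false _   y≤M x<y = ∸-monoʳ-< x<y y≤M
Slope-flip true  x≤M _   y<x = ∸-monoʳ-< y<x x≤M

opposite-injective : ∀ {n} → Injective _≡_ _≡_ (opposite {n})
opposite-injective eq = trans (sym (opposite-involutive _)) (trans (cong opposite eq) (opposite-involutive _))

∁-involutive : ∀ {m} (S : Subset m) → ∁ (∁ S) ≡ S
∁-involutive S = trans (sym (map-∘ not not S)) (trans (map-cong not-involutive S) (map-id S))

complement : ∀ {n} → Permutation′ n → Permutation′ n
complement σ = σ ∘ₚ reverse

module _ {m} {S : Subset m} where

  descentSet-complement : ∀ τ → HasDescentSet S τ → HasDescentSet (∁ S) (complement τ)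
  descentSet-complement τ H k = slope⇒descentAt
    (Slope-resp indicator-∁ (sym (opposite-prop (τ ⟨$⟩ʳ inject₁ k))) (sym (opposite-prop (τ ⟨$⟩ʳ Fin.suc k)))
      (Slope-flip _ (toℕ≤pred[n] _) (toℕ≤pred[n] _) (descentAt⇒slope (adjacent-distinct τ k) (H k))))
    where
    indicator-∁ : not (indicator S (toℕ k)) ≡ indicator (∁ S) (toℕ k)
    indicator-∁ = trans (cong not (indicator-lookup S k))
      (trans (sym (lookup-map k not S)) (sym (indicator-lookup (∁ S) k)))

module _ {n} (σ ρ : Permutation′ n) where

  dH-complement : dH (complement σ) (complement ρ) ≡ dH σ ρ
  dH-complement = cong ∣_∣ (⊆-antisym
    (λ x∈ → ∈-disagreement⁺ σ ρ λ eq → ∈-disagreement⁻ (complement σ) (complement ρ) x∈ (cong opposite eq))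
    (λ x∈ → ∈-disagreement⁺ (complement σ) (complement ρ) λ eq → ∈-disagreement⁻ σ ρ x∈ (opposite-injective eq)))

  ≉ₚ-complement : σ ≉ₚ ρ → complement σ ≉ₚ complement ρ
  ≉ₚ-complement σ≉ρ σᶜ≈ρᶜ = σ≉ρ λ x → opposite-injective (σᶜ≈ρᶜ x)

isMaxDist-∁ : ∀ {m M} {S : Subset m} → IsMaxDist (∁ S) M → IsMaxDist S M
isMaxDist-∁ {S = S} ((σ , ρ , Hσ , Hρ , σ≉ρ , dσρ) , maximal) =
  (complement σ , complement ρ , back σ Hσ , back ρ Hρ , ≉ₚ-complement σ ρ σ≉ρ ,
   trans (dH-complement σ ρ) dσρ) ,
  λ σ′ ρ′ Hσ′ Hρ′ σ′≉ρ′ → subst (_≤ _) (dH-complement σ′ ρ′)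
    (maximal (complement σ′) (complement ρ′) (descentSet-complement σ′ Hσ′) (descentSet-complement ρ′ Hρ′)
      (≉ₚ-complement σ′ ρ′ σ′≉ρ′))
  where
  back : ∀ τ → HasDescentSet (∁ S) τ → HasDescentSet S (complement τ)
  back τ H = subst (λ T → HasDescentSet T (complement τ)) (∁-involutive S) (descentSet-complement τ H)

consecutiveAtEnd-∁ : ∀ {m} {S : Subset m} → ConsecutiveAtEnd S → ConsecutiveAtEnd (∁ S)
consecutiveAtEnd-∁ {m} {S} (_ , j , S≡[1,j] , inj₁ refl) = suc j , m , (λ k → mk⇔ (to k) (from k)) , inj₂ refl
  where
  to : ∀ k → k ∈ ∁ S → suc j ≤ suc (toℕ k) × suc (toℕ k) ≤ m
  to k k∈∁S = s≤s (≮⇒≥ λ k<j → x∈∁p⇒x∉p k∈∁S (Equivalence.from (S≡[1,j] k) (s≤s z≤n , k<j))) , toℕ<n k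
  from : ∀ k → suc j ≤ suc (toℕ k) × suc (toℕ k) ≤ m → k ∈ ∁ S
  from k (j<k+1 , _) = x∉p⇒x∈∁p λ k∈S → ≤⇒≯ (s≤s⁻¹ j<k+1) (proj₂ (Equivalence.to (S≡[1,j] k) k∈S))
consecutiveAtEnd-∁ {m} {S} (i , _ , S≡[i,m] , inj₂ refl) = 1 , pred i , (λ k → mk⇔ (to k) (from k)) , inj₁ refl
  where
  to : ∀ k → k ∈ ∁ S → 1 ≤ suc (toℕ k) × suc (toℕ k) ≤ pred i
  to k k∈∁S = s≤s z≤n , suc[m]≤n⇒m≤pred[n] (≰⇒> λ i≤k+1 →
    x∈∁p⇒x∉p k∈∁S (Equivalence.from (S≡[i,m] k) (i≤k+1 , toℕ<n k)))
  from : ∀ k → 1 ≤ suc (toℕ k) × suc (toℕ k) ≤ pred i → k ∈ ∁ S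
  from k (_ , k+1≤pred) = x∉p⇒x∈∁p λ k∈S → <⇒≱ (≤pred⇒< i k+1≤pred) (proj₁ (Equivalence.to (S≡[i,m] k) k∈S))
    where
    ≤pred⇒< : ∀ {x} i → suc x ≤ pred i → suc x < i
    ≤pred⇒< (suc i) x<i = s≤s x<i

MaxDistDichotomy : ∀ {m} → Subset m → Set
MaxDistDichotomy {m} S = (ConsecutiveAtEnd S → IsMaxDist S m) × (¬ ConsecutiveAtEnd S → IsMaxDist S (suc m))

dichotomy-∁ : ∀ {m} {S : Subset m} → MaxDistDichotomy (∁ S) → MaxDistDichotomy S
dichotomy-∁ {S = S} (atEnd , notAtEnd) =
  (λ S-atEnd → isMaxDist-∁ (atEnd (consecutiveAtEnd-∁ S-atEnd))) ,
  (λ S-notAtEnd → isMaxDist-∁ (notAtEnd λ ∁S-atEnd →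
    S-notAtEnd (subst ConsecutiveAtEnd (∁-involutive S) (consecutiveAtEnd-∁ ∁S-atEnd))))

module WithFirstDescentRun {m} (S : Subset m) (run : FirstDescentRun (indicator S) m) where
  open FirstDescentRun run
  open WitnessWords run

  private
    i<m : i < m
    i<m = subst (i <_) (sym m≡) (<-≤-trans (m<m+n i z<s) (m≤m+n (i + suc c) r))

    i<m+1 : i < suc m
    i<m+1 = m<n⇒m<1+n i<m

    descentAtI : indicator S i ≡ true
    descentAtI = subst (λ x → indicator S x ≡ true) (+-identityʳ i) (descents 0 z≤n)

  peak : Fin (suc m)
  peak = fromℕ< i<m+1

  private
    σ̂-isPermutation : IsPermutation ⟨ suc m , at σ ⟩
    σ̂-isPermutation = resize IsPermutation len-σ σ-isPermutation

    ρ̂-isPermutation : IsPermutation ⟨ suc m , at ρ ⟩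
    ρ̂-isPermutation = resize IsPermutation len-ρ ρ-isPermutation

  σ̂ ρ̂ : Permutation′ (suc m)
  σ̂ = toPermutation _ σ̂-isPermutation
  ρ̂ = toPermutation _ ρ̂-isPermutation

  private
    σ̂-at : ∀ x → toℕ (σ̂ ⟨$⟩ʳ x) ≡ at σ (toℕ x)
    σ̂-at = toPermutation-at _ σ̂-isPermutation

    ρ̂-at : ∀ x → toℕ (ρ̂ ⟨$⟩ʳ x) ≡ at ρ (toℕ x)
    ρ̂-at = toPermutation-at _ ρ̂-isPermutation

  σ̂-descentSet : HasDescentSet S σ̂
  σ̂-descentSet = pattern⇒descentSet S σ̂ σ̂-at (resize (HasPattern (indicator S)) len-σ σ-pattern)

  ρ̂-descentSet : HasDescentSet S ρ̂
  ρ̂-descentSet = pattern⇒descentSet S ρ̂ ρ̂-at (resize (HasPattern (indicator S)) len-ρ ρ-pattern)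

  σ̂≢ρ̂ : ∀ x → toℕ x ≢ i → σ̂ ⟨$⟩ʳ x ≢ ρ̂ ⟨$⟩ʳ x
  σ̂≢ρ̂ x x≢i eq = σ≢ρ (toℕ x) x≢i (trans (sym (σ̂-at x)) (trans (cong toℕ eq) (ρ̂-at x)))

  σ̂≉ρ̂ : σ̂ ≉ₚ ρ̂
  σ̂≉ρ̂ σ̂≈ρ̂ = σ̂≢ρ̂ Fin.zero (<⇒≢ 1≤i) (σ̂≈ρ̂ Fin.zero)

  σ̂-at-peak : ∀ {x} → toℕ x ≡ i → toℕ (σ̂ ⟨$⟩ʳ x) ≡ toℕ (ρ̂ ⟨$⟩ʳ x) + r
  σ̂-at-peak {x} x≡i = trans (σ̂-at x)
    (trans (subst (λ p → at σ p ≡ at ρ p + r) (sym x≡i) σ-at-peak) (cong (_+ r) (sym (ρ̂-at x))))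

  dH-σ̂ρ̂≡m : r ≡ 0 → dH σ̂ ρ̂ ≡ m
  dH-σ̂ρ̂≡m r≡0 = dH-agreeOnlyAt σ̂ ρ̂ peak
    (toℕ-injective (trans (σ̂-at-peak (toℕ-fromℕ< i<m+1))
      (trans (cong (toℕ (ρ̂ ⟨$⟩ʳ peak) +_) r≡0) (+-identityʳ _))))
    λ y y≢peak → σ̂≢ρ̂ y λ y≡i → y≢peak (toℕ-injective (trans y≡i (sym (toℕ-fromℕ< i<m+1))))

  dH-σ̂ρ̂≡1+m : 0 < r → dH σ̂ ρ̂ ≡ suc m
  dH-σ̂ρ̂≡1+m 0<r = dH-everywhere σ̂ ρ̂ differ
    where
    differ : ∀ x → σ̂ ⟨$⟩ʳ x ≢ ρ̂ ⟨$⟩ʳ x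
    differ x with toℕ x ≟ℕ i
    ... | no  x≢i = σ̂≢ρ̂ x x≢i
    ... | yes x≡i = λ eq → <⇒≢ (m<m+n _ 0<r) (trans (sym (cong toℕ eq)) (σ̂-at-peak x≡i))

  peak-value : r ≡ 0 → ∀ τ → HasDescentSet S τ → toℕ (τ ⟨$⟩ʳ peak) ≡ m
  peak-value r≡0 τ H = ≤-antisym (toℕ≤pred[n] _) (begin
    m                            ≡⟨ toℕ-fromℕ m ⟨
    toℕ (fromℕ m)                ≡⟨ cong toℕ (inverseʳ τ) ⟨
    toℕ (τ ⟨$⟩ʳ top)             ≡⟨ oneLine-at τ top ⟩
    at (oneLine τ) (toℕ top)     ≤⟨ peak-maximal τ-pattern i<m+1 ascents descents′ (toℕ<n top) ⟩
    at (oneLine τ) i             ≡⟨ cong (at (oneLine τ)) (toℕ-fromℕ< i<m+1) ⟨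
    at (oneLine τ) (toℕ peak)    ≡⟨ oneLine-at τ peak ⟨
    toℕ (τ ⟨$⟩ʳ peak)            ∎)
    where
    open ≤-Reasoning
    top : Fin (suc m)
    top = τ ⟨$⟩ˡ fromℕ m
    τ-pattern : HasPattern (indicator S) (oneLine τ)
    τ-pattern = descentSet⇒pattern S τ (oneLine-at τ) H
    descents′ : ∀ j → i ≤ j → suc j < suc m → indicator S j ≡ true
    descents′ j i≤j j+1<m+1 = descentsToEnd r≡0 j i≤j (s≤s⁻¹ j+1<m+1)

  consecutiveAtEnd : r ≡ 0 → ConsecutiveAtEnd S
  consecutiveAtEnd r≡0 = suc i , m , (λ k → mk⇔ (to k) (from k)) , inj₂ refl
    where
    to : ∀ k → k ∈ S → suc i ≤ suc (toℕ k) × suc (toℕ k) ≤ m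
    to k k∈S = s≤s (≮⇒≥ λ k<i → not-¬ (ascents (toℕ k) k<i) (∈⇒indicator k∈S)) , toℕ<n k
    from : ∀ k → suc i ≤ suc (toℕ k) × suc (toℕ k) ≤ m → k ∈ S
    from k (i<k+1 , _) = indicator⇒∈ (descentsToEnd r≡0 (toℕ k) (s≤s⁻¹ i<k+1) (toℕ<n k))

  ¬consecutiveAtEnd : 0 < r → ¬ ConsecutiveAtEnd S
  ¬consecutiveAtEnd 0<r (_ , J , S≡[1,J] , inj₁ refl) = not-¬ (ascents 0 1≤i)
    (Equivalence.from (S≡ℕ (≤-<-trans z≤n i<m))
      (≤-refl , ≤-trans (s≤s z≤n) (proj₂ (Equivalence.to (S≡ℕ i<m) descentAtI))))
    where
    S≡ℕ : ∀ {j} → j < m → indicator S j ≡ true ⇔ (1 ≤ suc j × suc j ≤ J)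
    S≡ℕ = indicator⇔ (λ j → 1 ≤ suc j × suc j ≤ J) S≡[1,J]
  ¬consecutiveAtEnd 0<r (I , _ , S≡[I,m] , inj₂ refl) = not-¬ (ascentAfter 0<r)
    (Equivalence.from (S≡ℕ i+c+1<m)
      (≤-trans (proj₁ (Equivalence.to (S≡ℕ i<m) descentAtI)) (s≤s (m≤m+n i (suc c))) , i+c+1<m))
    where
    S≡ℕ : ∀ {j} → j < m → indicator S j ≡ true ⇔ (I ≤ suc j × suc j ≤ m)
    S≡ℕ = indicator⇔ (λ j → I ≤ suc j × suc j ≤ m) S≡[I,m]
    i+c+1<m : i + suc c < m
    i+c+1<m = subst (_ <_) (sym m≡) (m<m+n _ 0<r)

  isMaxDist-m : r ≡ 0 → IsMaxDist S m
  isMaxDist-m r≡0 = (σ̂ , ρ̂ , σ̂-descentSet , ρ̂-descentSet , σ̂≉ρ̂ , dH-σ̂ρ̂≡m r≡0) , λ τ τ′ H H′ _ →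
    dH-agreeAt τ τ′ peak (toℕ-injective (trans (peak-value r≡0 τ H) (sym (peak-value r≡0 τ′ H′))))

  isMaxDist-1+m : 0 < r → IsMaxDist S (suc m)
  isMaxDist-1+m 0<r = (σ̂ , ρ̂ , σ̂-descentSet , ρ̂-descentSet , σ̂≉ρ̂ , dH-σ̂ρ̂≡1+m 0<r) , λ τ τ′ _ _ _ →
    ∣p∣≤n (disagreement τ τ′)

  dichotomy : MaxDistDichotomy S
  dichotomy with r in r≡
  ... | zero  = (λ _ → isMaxDist-m r≡) , (λ notAtEnd → contradiction (consecutiveAtEnd r≡) notAtEnd)
  ... | suc _ = (λ atEnd → contradiction atEnd (¬consecutiveAtEnd 0<r)) , (λ _ → isMaxDist-1+m 0<r)
    where
    0<r : 0 < r
    0<r = subst (0 <_) (sym r≡) z<s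

dichotomy-ascentFirst : ∀ {m} (S : Subset m) → Nonempty S → indicator S 0 ≡ false → MaxDistDichotomy S
dichotomy-ascentFirst S (k , k∈S) 0∉S =
  WithFirstDescentRun.dichotomy S (firstDescentRun 0∉S (toℕ k , toℕ<n k , ∈⇒indicator k∈S))

theorem3p2 : (m : ℕ) → 2 ≤ m → (S : Subset m) → Nonempty S → ∃ (λ k → k ∉ S) →
    (ConsecutiveAtEnd S → IsMaxDist S m) × (¬ ConsecutiveAtEnd S → IsMaxDist S (suc m))
theorem3p2 (suc m) _ S nonempty (k , k∉S) with Fin.zero ∈? S
... | no  0∉S = dichotomy-ascentFirst S nonempty (∉⇒indicator 0∉S)
... | yes 0∈S = dichotomy-∁ (dichotomy-ascentFirst (∁ S) (k , x∉p⇒x∈∁p k∉S) (∉⇒indicator (x∈p⇒x∉∁p 0∈S)))
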